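{- Let $G$ be a nontrivial connected graph. Then $\mathrm{srd}(G)=2$ if and only if $\mathrm{rd}(G)=2$.
   Context: All graphs are simple, finite and undirected. An edge-coloring of $G$ is any map $c:E(G)\to[k]$ (adjacent edges may receive the same color). For distinct vertices $u,v$ of a connected graph $G$, a $u$-$v$-edge-cut is a set $F$ of edges such that $u$ and $v$ lie in different components of $G-F$; a minimum $u$-$v$-edge-cut is one of minimum size among these. A set of edges is rainbow if no two of its edges have the same color. An edge-colored connected graph is rainbow disconnected if for every two distinct vertices $u,v$ there is a rainbow $u$-$v$-edge-cut; $\mathrm{rd}(G)$ is the smallest number of colors of an edge-coloring making $G$ rainbow disconnected. An edge-colored connected graph is strong rainbow disconnected if for every two distinct vertices $u,v$ there is a $u$-$v$-edge-cut that is both rainbow and minimum; $\mathrm{srd}(G)$ is the smallest number of colors of an edge-coloring making $G$ strong rainbow disconnected. -}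

module Defs where

open import Data.Nat using (ℕ; _≤_; _<_)
open import Data.Fin using (Fin)
open import Data.Fin.Subset using (Subset; _∈_; _∉_; ∣_∣; ⊥)
open import Data.Product using (Σ; _×_; _,_; proj₁; proj₂)
open import Data.Sum using (_⊎_)
open import Relation.Binary.PropositionalEquality using (_≡_; _≢_)
open import Relation.Nullary using (¬_)

record Graph : Set where
  field
    n     : ℕ
    m     : ℕ
    ends  : Fin m → Fin n × Fin n
    loopless : ∀ e → proj₁ (ends e) ≢ proj₂ (ends e)
    noMulti  : ∀ e f →
      ((proj₁ (ends e) ≡ proj₁ (ends f)) × (proj₂ (ends e) ≡ proj₂ (ends f)))
      ⊎ ((proj₁ (ends e) ≡ proj₂ (ends f)) × (proj₂ (ends e) ≡ proj₁ (ends f)))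
      → e ≡ f
open Graph public

Vertex : Graph → Set
Vertex G = Fin (n G)

Edge : Graph → Set
Edge G = Fin (m G)

EdgeSet : Graph → Set
EdgeSet G = Subset (m G)

Joins : (G : Graph) → Edge G → Vertex G → Vertex G → Set
Joins G e u w = ((proj₁ (ends G e) ≡ u) × (proj₂ (ends G e) ≡ w))
              ⊎ ((proj₁ (ends G e) ≡ w) × (proj₂ (ends G e) ≡ u))

data Reach (G : Graph) (F : EdgeSet G) : Vertex G → Vertex G → Set where
  here : ∀ {u} → Reach G F u u
  step : ∀ {u w v} (e : Edge G) → e ∉ F → Joins G e u w → Reach G F w v → Reach G F u v

Connected : Graph → Set
Connected G = ∀ u v → Reach G ⊥ u v

Nontrivial : Graph → Set
Nontrivial G = 2 ≤ n G

IsCut : (G : Graph) → EdgeSet G → Vertex G → Vertex G → Set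
IsCut G F u v = ¬ Reach G F u v

IsMinCut : (G : Graph) → EdgeSet G → Vertex G → Vertex G → Set
IsMinCut G F u v = IsCut G F u v × (∀ F' → IsCut G F' u v → ∣ F ∣ ≤ ∣ F' ∣)

-- Edge-coloring with colors [k] (adjacent edges may share a color).
Coloring : Graph → ℕ → Set
Coloring G k = Edge G → Fin k

Rainbow : (G : Graph) {k : ℕ} → Coloring G k → EdgeSet G → Set
Rainbow G c F = ∀ e f → e ∈ F → f ∈ F → c e ≡ c f → e ≡ f

RainbowDisconnected : (G : Graph) {k : ℕ} → Coloring G k → Set
RainbowDisconnected G c =
  ∀ u v → u ≢ v → Σ (EdgeSet G) λ F → IsCut G F u v × Rainbow G c F

StrongRainbowDisconnected : (G : Graph) {k : ℕ} → Coloring G k → Set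
StrongRainbowDisconnected G c =
  ∀ u v → u ≢ v → Σ (EdgeSet G) λ F → IsMinCut G F u v × Rainbow G c F

rd≡ : Graph → ℕ → Set
rd≡ G k = Σ (Coloring G k) (RainbowDisconnected G)
        × (∀ j → j < k → ¬ Σ (Coloring G j) (RainbowDisconnected G))

srd≡ : Graph → ℕ → Set
srd≡ G k = Σ (Coloring G k) (StrongRainbowDisconnected G)
         × (∀ j → j < k → ¬ Σ (Coloring G j) (StrongRainbowDisconnected G))

-- A strongly rainbow disconnecting colouring is rainbow disconnecting, so it
-- suffices to see that a rainbow disconnecting colouring c with at most two
-- colours is strong. Fix u ≠ v. If a single edge separates them, that edge is a
-- rainbow cut, and it is minimum because G is connected. Otherwise every u-v
-- cut has at least two edges, while the rainbow cut provided by c has at most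
-- as many edges as there are colours, i.e. at most two, so it is minimum.
-- Constructively the case split needs reachability in G - F to be decidable;
-- it is decided by growing the set reached from u until it is closed.
module Submission where

open import Defs
open import Data.Empty using (⊥-elim)
open import Data.Fin using (Fin; zero; suc; _≟_)
open import Data.Fin.Properties using (any?; 0≢1+n; suc-injective)
open import Data.Fin.Subset
  using (Subset; _∈_; _∉_; _⊆_; _⊂_; ∣_∣; ⁅_⁆; _∪_; _-_; ⊥; ⊤; inside; outside)
open import Data.Fin.Subset.Properties
  using ( _∈?_; ∈⊤; ∉⊥; ∣⊤∣≡n; ∣p∣≤n; x∈⁅x⁆; x∈⁅y⁆⇒x≡y; ∣⁅x⁆∣≡1; p⊂q⇒∣p∣<∣q∣
        ; p⊆p∪q; q⊆p∪q; x∈p∪q⁻; x∈p∧x≢y⇒x∈p-y; x∈p⇒∣p-x∣<∣p∣ )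
open import Data.Nat using (zero; suc; _+_; _≤_; _<_; z≤n; s≤s; _≤?_)
open import Data.Nat.Properties
  using (≤-trans; ≤-refl; <⇒≤; ≰⇒>; <⇒≱; <-≤-trans; +-suc; +-monoʳ-≤; m<m+n)
open import Data.Product using (∃; _×_; _,_; proj₁; proj₂)
open import Data.Sum using (_⊎_; inj₁; inj₂)
open import Data.Vec.Base using ([]; _∷_; here; there)
open import Relation.Nullary using (¬_; Dec; yes; no; ¬?)
open import Relation.Nullary.Decidable using (_×-dec_; _⊎-dec_)
open import Relation.Binary.PropositionalEquality using (_≡_; sym; trans; subst)

injectiveOn⇒∣p∣≤∣q∣ : ∀ {m k} {p : Subset m} {q : Subset k} (f : Fin m → Fin k) →
  (∀ {i} → i ∈ p → f i ∈ q) →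
  (∀ {i j} → i ∈ p → j ∈ p → f i ≡ f j → i ≡ j) →
  ∣ p ∣ ≤ ∣ q ∣
injectiveOn⇒∣p∣≤∣q∣ {p = []} f maps inj = z≤n
injectiveOn⇒∣p∣≤∣q∣ {p = outside ∷ p} f maps inj =
  injectiveOn⇒∣p∣≤∣q∣ (λ i → f (suc i)) (λ i∈p → maps (there i∈p))
    (λ i∈p j∈p eq → suc-injective (inj (there i∈p) (there j∈p) eq))
injectiveOn⇒∣p∣≤∣q∣ {p = inside ∷ p} {q} f maps inj =
  ≤-trans (s≤s (injectiveOn⇒∣p∣≤∣q∣ (λ i → f (suc i)) maps′ inj′)) (x∈p⇒∣p-x∣<∣p∣ (maps here))
  where
  maps′ : ∀ {i} → i ∈ p → f (suc i) ∈ q - f zero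
  maps′ i∈p = x∈p∧x≢y⇒x∈p-y (maps (there i∈p)) λ eq → 0≢1+n (sym (inj (there i∈p) here eq))
  inj′ : ∀ {i j} → i ∈ p → j ∈ p → f (suc i) ≡ f (suc j) → i ≡ j
  inj′ i∈p j∈p eq = suc-injective (inj (there i∈p) (there j∈p) eq)

∣p∣≤0⇒p⊆⊥ : ∀ {m} {p : Subset m} → ∣ p ∣ ≤ 0 → p ⊆ ⊥
∣p∣≤0⇒p⊆⊥ {p = outside ∷ p} h (there x∈p) = there (∣p∣≤0⇒p⊆⊥ h x∈p)
∣p∣≤0⇒p⊆⊥ {p = inside ∷ p} () here

∣p∣≤1⇒p⊆⊥⊎p⊆⁅x⁆ : ∀ {m} {p : Subset m} → ∣ p ∣ ≤ 1 → p ⊆ ⊥ ⊎ ∃ λ x → p ⊆ ⁅ x ⁆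
∣p∣≤1⇒p⊆⊥⊎p⊆⁅x⁆ {p = []} h = inj₁ λ ()
∣p∣≤1⇒p⊆⊥⊎p⊆⁅x⁆ {p = outside ∷ p} h with ∣p∣≤1⇒p⊆⊥⊎p⊆⁅x⁆ {p = p} h
... | inj₁ p⊆⊥ = inj₁ λ { (there x∈p) → there (p⊆⊥ x∈p) }
... | inj₂ (x , p⊆x) = inj₂ (suc x , λ { (there y∈p) → there (p⊆x y∈p) })
∣p∣≤1⇒p⊆⊥⊎p⊆⁅x⁆ {p = inside ∷ p} (s≤s h) =
  inj₂ (zero , λ { here → here ; (there y∈p) → ⊥-elim (∉⊥ (∣p∣≤0⇒p⊆⊥ h y∈p)) })

module _ {G : Graph} where

  Reach-snoc : ∀ {F u w x} → Reach G F u w →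
    (e : Edge G) → e ∉ F → Joins G e w x → Reach G F u x
  Reach-snoc here e e∉F joins = step e e∉F joins here
  Reach-snoc (step e′ e′∉F joins′ r) e e∉F joins = step e′ e′∉F joins′ (Reach-snoc r e e∉F joins)

  Reach-antitone : ∀ {F F′ u v} → F ⊆ F′ → Reach G F′ u v → Reach G F u v
  Reach-antitone F⊆F′ here = here
  Reach-antitone F⊆F′ (step e e∉F′ joins r) =
    step e (λ e∈F → e∉F′ (F⊆F′ e∈F)) joins (Reach-antitone F⊆F′ r)

  IsCut-superset : ∀ {F F′ u v} → F ⊆ F′ → IsCut G F u v → IsCut G F′ u v
  IsCut-superset F⊆F′ cut r = cut (Reach-antitone F⊆F′ r)

module Reachability (G : Graph) (F : EdgeSet G) where

  joins? : ∀ e a x → Dec (Joins G e a x)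
  joins? e a x = ((proj₁ (ends G e) ≟ a) ×-dec (proj₂ (ends G e) ≟ x))
           ⊎-dec ((proj₁ (ends G e) ≟ x) ×-dec (proj₂ (ends G e) ≟ a))

  StepFrom : Subset (n G) → Vertex G → Set
  StepFrom S x = ∃ λ e → e ∉ F × ∃ λ a → a ∈ S × Joins G e a x

  stepFrom? : ∀ S x → Dec (StepFrom S x)
  stepFrom? S x = any? λ e → ¬? (e ∈? F) ×-dec any? λ a → (a ∈? S) ×-dec joins? e a x

  Closed : Subset (n G) → Set
  Closed S = ∀ {x} → StepFrom S x → x ∈ S

  Closed⇒Reach-∈ : ∀ {S a v} → Closed S → a ∈ S → Reach G F a v → v ∈ S
  Closed⇒Reach-∈ closed a∈S here = a∈S
  Closed⇒Reach-∈ closed a∈S (step e e∉F joins r) =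
    Closed⇒Reach-∈ closed (closed (e , e∉F , _ , a∈S , joins)) r

  ReachableFrom : Vertex G → Subset (n G) → Set
  ReachableFrom u S = ∀ {x} → x ∈ S → Reach G F u x

  Component : Vertex G → Subset (n G) → Set
  Component u S = ReachableFrom u S × u ∈ S × Closed S

  -- The fuel bound makes the recursion terminate: every round adds a vertex.
  grow : ∀ {u} fuel S → n G < fuel + ∣ S ∣ → ReachableFrom u S → u ∈ S → ∃ (Component u)
  grow zero S size _ _ = ⊥-elim (<⇒≱ size (∣p∣≤n S))
  grow {u} (suc fuel) S size reach u∈S with any? (λ x → stepFrom? S x ×-dec ¬? (x ∈? S))
  ... | no noNewVertex = S , reach , u∈S , closed
    where
    closed : Closed S
    closed {x} s with x ∈? S
    ... | yes x∈S = x∈S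
    ... | no x∉S = ⊥-elim (noNewVertex (x , s , x∉S))
  ... | yes (x , (e , e∉F , a , a∈S , joins) , x∉S) =
    grow fuel (S ∪ ⁅ x ⁆) size′ reach′ (p⊆p∪q ⁅ x ⁆ u∈S)
    where
    S⊂S′ : S ⊂ S ∪ ⁅ x ⁆
    S⊂S′ = p⊆p∪q ⁅ x ⁆ , x , q⊆p∪q S ⁅ x ⁆ (x∈⁅x⁆ x) , x∉S
    size′ : n G < fuel + ∣ S ∪ ⁅ x ⁆ ∣
    size′ = <-≤-trans size (subst (_≤ fuel + ∣ S ∪ ⁅ x ⁆ ∣) (+-suc fuel ∣ S ∣)
              (+-monoʳ-≤ fuel (p⊂q⇒∣p∣<∣q∣ S⊂S′)))
    reach′ : ReachableFrom u (S ∪ ⁅ x ⁆)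
    reach′ y∈S′ with x∈p∪q⁻ S ⁅ x ⁆ y∈S′
    ... | inj₁ y∈S = reach y∈S
    ... | inj₂ y∈⁅x⁆ rewrite x∈⁅y⁆⇒x≡y x y∈⁅x⁆ = Reach-snoc (reach a∈S) e e∉F joins

  component : ∀ u → ∃ (Component u)
  component u = grow (n G) ⁅ u ⁆ size reach (x∈⁅x⁆ u)
    where
    size : n G < n G + ∣ ⁅ u ⁆ ∣
    size = subst (λ k → n G < n G + k) (sym (∣⁅x⁆∣≡1 u)) (m<m+n (n G) (s≤s z≤n))
    reach : ReachableFrom u ⁅ u ⁆
    reach x∈⁅u⁆ rewrite x∈⁅y⁆⇒x≡y u x∈⁅u⁆ = here

  reach? : ∀ u v → Dec (Reach G F u v)
  reach? u v with component u
  ... | S , reach , u∈S , closed with v ∈? S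
  ... | yes v∈S = yes (reach v∈S)
  ... | no v∉S = no λ r → v∉S (Closed⇒Reach-∈ closed u∈S r)

module _ (G : Graph) where

  rainbow⇒∣F∣≤k : ∀ {k F} (c : Coloring G k) → Rainbow G c F → ∣ F ∣ ≤ k
  rainbow⇒∣F∣≤k {k} c rainbow =
    subst (_ ≤_) (∣⊤∣≡n k) (injectiveOn⇒∣p∣≤∣q∣ c (λ _ → ∈⊤) (rainbow _ _))

  ⁅e⁆-rainbow : ∀ {k} (c : Coloring G k) e → Rainbow G c ⁅ e ⁆
  ⁅e⁆-rainbow c e f g f∈⁅e⁆ g∈⁅e⁆ _ = trans (x∈⁅y⁆⇒x≡y e f∈⁅e⁆) (sym (x∈⁅y⁆⇒x≡y e g∈⁅e⁆))

  srd⇒rd : ∀ {k} (c : Coloring G k) → StrongRainbowDisconnected G c → RainbowDisconnected G c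
  srd⇒rd c srd u v u≢v with srd u v u≢v
  ... | F , (cut , _) , rainbow = F , cut , rainbow

module _ {G : Graph} (connected : Connected G) where

  1≤∣cut∣ : ∀ {F u v} → IsCut G F u v → 1 ≤ ∣ F ∣
  1≤∣cut∣ {F} {u} {v} cut with ∣ F ∣ ≤? 0
  ... | no ∣F∣≰0 = ≰⇒> ∣F∣≰0
  ... | yes ∣F∣≤0 = ⊥-elim (IsCut-superset (∣p∣≤0⇒p⊆⊥ ∣F∣≤0) cut (connected u v))

  bridge⇒minCut : ∀ {e u v} → IsCut G ⁅ e ⁆ u v → IsMinCut G ⁅ e ⁆ u v
  bridge⇒minCut {e} cut = cut , λ F cut′ → subst (_≤ ∣ F ∣) (sym (∣⁅x⁆∣≡1 e)) (1≤∣cut∣ cut′)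

  noBridge⇒2≤∣cut∣ : ∀ {F u v} → (∀ e → ¬ IsCut G ⁅ e ⁆ u v) → IsCut G F u v → 2 ≤ ∣ F ∣
  noBridge⇒2≤∣cut∣ {F} {u} {v} noBridge cut with ∣ F ∣ ≤? 1
  ... | no ∣F∣≰1 = ≰⇒> ∣F∣≰1
  ... | yes ∣F∣≤1 with ∣p∣≤1⇒p⊆⊥⊎p⊆⁅x⁆ ∣F∣≤1
  ...   | inj₁ F⊆⊥ = ⊥-elim (IsCut-superset F⊆⊥ cut (connected u v))
  ...   | inj₂ (e , F⊆⁅e⁆) = ⊥-elim (noBridge e (IsCut-superset F⊆⁅e⁆ cut))

  rd⇒srd : ∀ {k} → k ≤ 2 → (c : Coloring G k) →
    RainbowDisconnected G c → StrongRainbowDisconnected G c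
  rd⇒srd k≤2 c rd u v u≢v with any? (λ e → ¬? (Reachability.reach? G ⁅ e ⁆ u v))
  ... | yes (e , cut) = ⁅ e ⁆ , bridge⇒minCut cut , ⁅e⁆-rainbow G c e
  ... | no noBridge with rd u v u≢v
  ...   | F , cut , rainbow = F , (cut , minimum) , rainbow
    where
    minimum : ∀ F′ → IsCut G F′ u v → ∣ F ∣ ≤ ∣ F′ ∣
    minimum F′ cut′ = ≤-trans (≤-trans (rainbow⇒∣F∣≤k G c rainbow) k≤2)
                        (noBridge⇒2≤∣cut∣ (λ e cut″ → noBridge (e , cut″)) cut′)

theorem2p9 : (G : Graph) → Nontrivial G → Connected G →
    (srd≡ G 2 → rd≡ G 2) × (rd≡ G 2 → srd≡ G 2)
theorem2p9 G _ connected =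
  (λ ((c , srd) , fewer) →
     (c , srd⇒rd G c srd) , λ j j<2 (c′ , rd) → fewer j j<2 (c′ , rd⇒srd connected (<⇒≤ j<2) c′ rd)) ,
  (λ ((c , rd) , fewer) →
     (c , rd⇒srd connected ≤-refl c rd) , λ j j<2 (c′ , srd) → fewer j j<2 (c′ , srd⇒rd G c′ srd))
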